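{- Let $\mathcal{D}$ be a Ryser design of order $v$ and index $\lambda$, with replication numbers $r_1>r_2$, and let $\rho=(r_1-1)/(r_2-1)$. For $i=1,2$ let $E_i$ be the set of points with replication number $r_i$ and $e_i=|E_i|$. Order the points so that the $e_1$ points of $E_1$ come first, and let $\mathsf{A}$ be the $v\times v$ point-block incidence matrix of $\mathcal{D}$ (rows indexed by points, columns by blocks), with block sizes (column sums) $k_1,\dots,k_v$. Let $\mathsf{D}=\mathrm{diag}(k_1-\lambda,\dots,k_v-\lambda)$ and $$\mathsf{R}=\begin{pmatrix}\rho\,\mathsf{J}_{e_1\times e_1} & \mathsf{J}_{e_1\times e_2}\\ \mathsf{J}_{e_2\times e_1} & \frac{1}{\rho}\mathsf{J}_{e_2\times e_2}\end{pmatrix},$$ where $\mathsf{J}$ denotes an all-ones matrix of the indicated size. Then $\mathsf{A}$ is invertible and $$\mathsf{A}^{ -1}=\mathsf{D}^{ -1}\mathsf{A}^T(\mathsf{I}_v+\mathsf{R})^{ -1}=\mathsf{D}^{ -1}\mathsf{A}^T\left(\mathsf{I}_v-\frac{\rho}{\lambda(\rho+1)^2}\mathsf{R}\right).$$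
   Context: A Ryser design of order $v$ and index $\lambda$ is a pair $(X,L)$ where $X$ is a set of $v$ points and $L$ is a collection of $v$ subsets (blocks) of $X$ such that any two distinct blocks meet in exactly $\lambda$ points, every block has size $>\lambda$, and there exist two blocks of different sizes. It is known (Ryser–Woodall) that there are integers $r_1\neq r_2$ with $r_1+r_2=v+1$ such that every point lies in exactly $r_1$ or exactly $r_2$ blocks; the labels are chosen so that $r_1>r_2$, and both sets $E_1,E_2$ are nonempty. -}

module Defs where

open import Data.Nat as ℕ using (ℕ; zero; suc; _<_)
open import Data.Bool using (Bool; true; false; if_then_else_; _∧_)
open import Data.Fin using (Fin; zero; suc; splitAt)
open import Data.Sum using (_⊎_; inj₁; inj₂)
open import Data.Product using (∃₂; _×_)
open import Data.Rational as ℚ using (ℚ; 0ℚ; 1ℚ; _÷_; _≟_; ≢-nonZero)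
import Data.Integer
open import Relation.Nullary using (yes; no; ¬_)
open import Relation.Binary.PropositionalEquality using (_≡_; _≢_)

count : ∀ n → (Fin n → Bool) → ℕ
count zero    f = 0
count (suc n) f = (if f zero then 1 else 0) ℕ.+ count n (λ i → f (suc i))

sumℚ : ∀ n → (Fin n → ℚ) → ℚ
sumℚ zero    f = 0ℚ
sumℚ (suc n) f = f zero ℚ.+ sumℚ n (λ i → f (suc i))

-- division in ℚ, total (junk value 0 when dividing by 0; never used
-- with a zero divisor in a genuine Ryser design)
divℚ : ℚ → ℚ → ℚ
divℚ p q with q ≟ 0ℚ
... | yes _  = 0ℚ
... | no q≢0 = _÷_ p q {{≢-nonZero q≢0}}

Mat : ℕ → Set
Mat n = Fin n → Fin n → ℚ

_⊗_ : ∀ {n} → Mat n → Mat n → Mat n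
(M ⊗ N) i j = sumℚ _ (λ k → M i k ℚ.* N k j)

_⊕_ : ∀ {n} → Mat n → Mat n → Mat n
(M ⊕ N) i j = M i j ℚ.+ N i j

_⊖_ : ∀ {n} → Mat n → Mat n → Mat n
(M ⊖ N) i j = M i j ℚ.- N i j

_·_ : ∀ {n} → ℚ → Mat n → Mat n
(c · M) i j = c ℚ.* M i j

transpose : ∀ {n} → Mat n → Mat n
transpose M i j = M j i

idMat : ∀ {n} → Mat n
idMat {suc n} zero    zero    = 1ℚ
idMat {suc n} zero    (suc j) = 0ℚ
idMat {suc n} (suc i) zero    = 0ℚ
idMat {suc n} (suc i) (suc j) = idMat {n} i j

diag : ∀ {n} → (Fin n → ℚ) → Mat n
diag d i j = d i ℚ.* idMat i j

-- Incidence structures with v points and v blocks: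
-- inc p b = true  iff point p lies in block b.
Incidence : ℕ → Set
Incidence v = Fin v → Fin v → Bool

blockSize : ∀ {v} → Incidence v → Fin v → ℕ
blockSize {v} inc b = count v (λ p → inc p b)

replication : ∀ {v} → Incidence v → Fin v → ℕ
replication {v} inc p = count v (λ b → inc p b)

record IsRyserDesign (v : ℕ) (inc : Incidence v) (λ' : ℕ) : Set where
  field
    meet      : ∀ b b' → b ≢ b' → count v (λ p → inc p b ∧ inc p b') ≡ λ'
    bigBlocks : ∀ b → λ' < blockSize inc b
    twoSizes  : ∃₂ λ b b' → blockSize inc b ≢ blockSize inc b'

incMat : ∀ {v} → Incidence v → Mat v
incMat inc p b = if inc p b then 1ℚ else 0ℚ

-- The matrix R, for points ordered so that the e₁ points of E₁ come first
Rmat : ∀ e₁ e₂ → ℚ → Mat (e₁ ℕ.+ e₂)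
Rmat e₁ e₂ ρ i j with splitAt e₁ i | splitAt e₁ j
... | inj₁ _ | inj₁ _ = ρ
... | inj₂ _ | inj₂ _ = divℚ 1ℚ ρ
... | _      | _      = 1ℚ

ℕtoℚ : ℕ → ℚ
ℕtoℚ n = (Data.Integer.+ n) ℚ./ 1

_≈M_ : ∀ {n} → Mat n → Mat n → Set
M ≈M N = ∀ i j → M i j ≡ N i j

infixl 7 _⊗_
infixl 6 _⊕_ _⊖_
infixr 8 _·_
infix 4 _≈M_

module Submission where

-- Let A be the incidence matrix, Δ = diag(k_b − λ), d = Δ⁻¹𝟏 and J the
-- all-ones matrix.  The argument has four steps.
--  1. Two blocks meet in λ points, so AᵀA = Δ + λJ.  By Sherman–Morrison,
--     N = Δ⁻¹ − c₀ddᵀ with c₀ = λ/(1 + λΣd) is a left inverse of Δ + λJ,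
--     hence G = NAᵀ is a left inverse of A.
--  2. AG = ANAᵀ is symmetric and idempotent of trace n.  Over ℚ such a matrix
--     is the identity (the squares of the entries of AG − I sum to zero),
--     so G = A⁻¹.
--  3. Writing x = Ad, the identity AG = I reads AΔ⁻¹Aᵀ = I + c₀xxᵀ.  Its
--     diagonal gives xₚ = 1 + c₀xₚ², its row sums give rₚ − 1 = t·xₚ for a
--     constant t ≠ 0.  Hence x equals x₁ on E₁ and x₂ on E₂, the two roots
--     of c₀X² − X + 1, so
--     c₀(x₁ + x₂) = c₀x₁x₂ = 1, ρ = x₁/x₂ and R = c₀xxᵀ, i.e. I + R = AΔ⁻¹Aᵀ.
--  4. Aᵀx is the constant vector 1 + λΣd, which gives Δ⁻¹AᵀS = G for
--     S = I − cR.  So A⁻¹ = Δ⁻¹AᵀS and (I + R)S = AΔ⁻¹AᵀS = AG = I; the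
--     reverse product follows by symmetry of I + R and S.

open import Defs
open import Data.Nat as ℕ using (ℕ; suc; _<_; _∸_)
open import Data.Fin using (Fin; splitAt)
open import Data.Sum using (inj₁; inj₂)
open import Data.Product using (_×_)
open import Relation.Binary.PropositionalEquality using (_≡_)
open import Data.Rational as ℚ using (ℚ; 1ℚ)

open import Data.Nat using (zero)
import Data.Nat.Properties as ℕP
open import Data.Fin as F using (zero; suc; _↑ˡ_; _↑ʳ_)
import Data.Fin.Properties as FP
open import Data.Bool using (Bool; true; false; if_then_else_; _∧_)
open import Data.Rational using (mkℚ; 0ℚ; _+_; _*_; _-_; -_; _≤_)
import Data.Rational.Properties as ℚP
import Data.Rational.Unnormalised as ℚᵘ
import Data.Rational.Unnormalised.Properties as ℚᵘP
import Data.Integer as ℤ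
import Data.Integer.Properties as ℤP
import Data.Nat.Coprimality as Cop
open import Data.Rational.Solver using (module +-*-Solver)
open +-*-Solver
open import Relation.Binary.PropositionalEquality
  using (_≢_; refl; sym; trans; cong; cong₂; subst; module ≡-Reasoning)
open import Relation.Nullary using (yes; no)
open import Data.Empty using (⊥-elim)
open import Data.Product using (_,_; proj₁; proj₂)

sum-cong : ∀ n {f g : Fin n → ℚ} → (∀ i → f i ≡ g i) → sumℚ n f ≡ sumℚ n g
sum-cong zero    f≗g = refl
sum-cong (suc n) f≗g = cong₂ _+_ (f≗g zero) (sum-cong n (λ i → f≗g (suc i)))

sum-zero : ∀ n → sumℚ n (λ _ → 0ℚ) ≡ 0ℚ
sum-zero zero    = refl
sum-zero (suc n) = trans (cong (0ℚ +_) (sum-zero n)) (ℚP.+-identityʳ 0ℚ)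

sum-+ : ∀ n (f g : Fin n → ℚ) → sumℚ n (λ i → f i + g i) ≡ sumℚ n f + sumℚ n g
sum-+ zero    f g = refl
sum-+ (suc n) f g =
  trans (cong ((f zero + g zero) +_) (sum-+ n (λ i → f (suc i)) (λ i → g (suc i))))
        (interchange (f zero) (g zero) _ _)
  where
  interchange : ∀ a b c d → (a + b) + (c + d) ≡ (a + c) + (b + d)
  interchange = solve 4 (λ a b c d → (a :+ b) :+ (c :+ d) := (a :+ c) :+ (b :+ d)) refl

sum-*ˡ : ∀ n c (f : Fin n → ℚ) → sumℚ n (λ i → c * f i) ≡ c * sumℚ n f
sum-*ˡ zero    c f = sym (ℚP.*-zeroʳ c)
sum-*ˡ (suc n) c f =
  trans (cong ((c * f zero) +_) (sum-*ˡ n c _)) (sym (ℚP.*-distribˡ-+ c _ _))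

sum-*ʳ : ∀ n c (f : Fin n → ℚ) → sumℚ n (λ i → f i * c) ≡ sumℚ n f * c
sum-*ʳ n c f =
  trans (sum-cong n (λ i → ℚP.*-comm (f i) c)) (trans (sum-*ˡ n c f) (ℚP.*-comm c _))

sum-neg : ∀ n (f : Fin n → ℚ) → sumℚ n (λ i → - f i) ≡ - sumℚ n f
sum-neg zero    f = refl
sum-neg (suc n) f =
  trans (cong ((- f zero) +_) (sum-neg n _)) (sym (ℚP.neg-distrib-+ (f zero) _))

sum-- : ∀ n (f g : Fin n → ℚ) → sumℚ n (λ i → f i - g i) ≡ sumℚ n f - sumℚ n g
sum-- n f g = trans (sum-+ n f (λ i → - g i)) (cong (sumℚ n f +_) (sum-neg n g))

sum-swap : ∀ n m (f : Fin n → Fin m → ℚ) →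
  sumℚ n (λ i → sumℚ m (f i)) ≡ sumℚ m (λ j → sumℚ n (λ i → f i j))
sum-swap zero    m f = sym (sum-zero m)
sum-swap (suc n) m f = begin
  sumℚ m (f zero) + sumℚ n (λ i → sumℚ m (f (suc i)))
    ≡⟨ cong (sumℚ m (f zero) +_) (sum-swap n m (λ i → f (suc i))) ⟩
  sumℚ m (f zero) + sumℚ m (λ j → sumℚ n (λ i → f (suc i) j))
    ≡⟨ sym (sum-+ m (f zero) _) ⟩
  sumℚ m (λ j → f zero j + sumℚ n (λ i → f (suc i) j)) ∎
  where open ≡-Reasoning

1≢0 : 1ℚ ≢ 0ℚ
1≢0 ()

sq-nonneg : ∀ p → 0ℚ ≤ p * p
sq-nonneg p with ℚP.≤-total 0ℚ p
... | inj₁ 0≤p = ℚP.nonNegative⁻¹ _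
      {{ℚP.nonNeg*nonNeg⇒nonNeg p {{ℚ.nonNegative 0≤p}} p {{ℚ.nonNegative 0≤p}}}}
... | inj₂ p≤0 = ℚP.nonNegative⁻¹ _
      {{ℚP.nonPos*nonPos⇒nonPos p {{ℚ.nonPositive p≤0}} p {{ℚ.nonPositive p≤0}}}}

sum-nonneg : ∀ n (f : Fin n → ℚ) → (∀ i → 0ℚ ≤ f i) → 0ℚ ≤ sumℚ n f
sum-nonneg zero    f f≥0 = ℚP.≤-refl
sum-nonneg (suc n) f f≥0 = ℚP.+-mono-≤ (f≥0 zero) (sum-nonneg n _ (λ i → f≥0 (suc i)))

nonneg-+-zero : ∀ a b → 0ℚ ≤ a → 0ℚ ≤ b → a + b ≡ 0ℚ → a ≡ 0ℚ
nonneg-+-zero a b 0≤a 0≤b a+b≡0 = ℚP.≤-antisym a≤0 0≤a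
  where
  a≤0 : a ≤ 0ℚ
  a≤0 = subst (a ≤_) a+b≡0 (subst (_≤ a + b) (ℚP.+-identityʳ a) (ℚP.+-monoʳ-≤ a 0≤b))

nonneg-sum-zero : ∀ n (f : Fin n → ℚ) → (∀ i → 0ℚ ≤ f i) → sumℚ n f ≡ 0ℚ →
  ∀ i → f i ≡ 0ℚ
nonneg-sum-zero (suc n) f f≥0 Σ≡0 zero =
  nonneg-+-zero _ _ (f≥0 zero) (sum-nonneg n _ (λ i → f≥0 (suc i))) Σ≡0
nonneg-sum-zero (suc n) f f≥0 Σ≡0 (suc i) =
  nonneg-sum-zero n _ (λ i → f≥0 (suc i))
    (nonneg-+-zero _ _ (sum-nonneg n _ (λ i → f≥0 (suc i))) (f≥0 zero)
      (trans (ℚP.+-comm (sumℚ n (λ i → f (suc i))) (f zero)) Σ≡0)) i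

*-zero-cancelˡ : ∀ a b → a ≢ 0ℚ → a * b ≡ 0ℚ → b ≡ 0ℚ
*-zero-cancelˡ a b a≢0 ab≡0 = begin
  b              ≡⟨ sym (ℚP.*-identityˡ b) ⟩
  1ℚ * b         ≡⟨ cong (_* b) (sym (ℚP.*-inverseˡ a {{nz}})) ⟩
  a⁻¹ * a * b    ≡⟨ ℚP.*-assoc a⁻¹ a b ⟩
  a⁻¹ * (a * b)  ≡⟨ cong (a⁻¹ *_) ab≡0 ⟩
  a⁻¹ * 0ℚ       ≡⟨ ℚP.*-zeroʳ a⁻¹ ⟩
  0ℚ             ∎
  where
  open ≡-Reasoning
  nz = ℚ.≢-nonZero a≢0
  a⁻¹ = (ℚ.1/ a) {{nz}}

sq-zero : ∀ p → p * p ≡ 0ℚ → p ≡ 0ℚ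
sq-zero p pp≡0 with p ℚP.≟ 0ℚ
... | yes p≡0 = p≡0
... | no  p≢0 = *-zero-cancelˡ p p p≢0 pp≡0

*-nonzero : ∀ a b → a ≢ 0ℚ → b ≢ 0ℚ → a * b ≢ 0ℚ
*-nonzero a b a≢0 b≢0 ab≡0 = b≢0 (*-zero-cancelˡ a b a≢0 ab≡0)

difference-zero : ∀ a b → a - b ≡ 0ℚ → a ≡ b
difference-zero a b a-b≡0 = begin
  a             ≡⟨ solve 2 (λ a b → a := (a :- b) :+ b) refl a b ⟩
  (a - b) + b   ≡⟨ cong (_+ b) a-b≡0 ⟩
  0ℚ + b        ≡⟨ ℚP.+-identityˡ b ⟩
  b             ∎
  where open ≡-Reasoning

*-cancelʳ : ∀ a b c → c ≢ 0ℚ → a * c ≡ b * c → a ≡ b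
*-cancelʳ a b c c≢0 ac≡bc = difference-zero a b (*-zero-cancelˡ c (a - b) c≢0 c[a-b]≡0)
  where
  c[a-b]≡0 : c * (a - b) ≡ 0ℚ
  c[a-b]≡0 = trans (solve 3 (λ a b c → c :* (a :- b) := (a :* c) :- (b :* c)) refl a b c)
               (trans (cong (_- (b * c)) ac≡bc) (ℚP.+-inverseʳ (b * c)))

divℚ-spec : ∀ p q → q ≢ 0ℚ → divℚ p q * q ≡ p
divℚ-spec p q q≢0 with q ℚP.≟ 0ℚ
... | yes q≡0 = ⊥-elim (q≢0 q≡0)
... | no  _   = begin
  p * ℚ.1/ q * q    ≡⟨ ℚP.*-assoc p _ q ⟩
  p * (ℚ.1/ q * q)  ≡⟨ cong (p *_) (ℚP.*-inverseˡ q) ⟩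
  p * 1ℚ            ≡⟨ ℚP.*-identityʳ p ⟩
  p                 ∎
  where
  open ≡-Reasoning
  instance _ = ℚ.≢-nonZero q≢0

divℚ-unique : ∀ p q z → q ≢ 0ℚ → z * q ≡ p → divℚ p q ≡ z
divℚ-unique p q z q≢0 zq≡p = *-cancelʳ _ _ q q≢0 (trans (divℚ-spec p q q≢0) (sym zq≡p))

recip-pos-nonneg : ∀ q → .{{ℚ.Positive q}} → 0ℚ ≤ divℚ 1ℚ q
recip-pos-nonneg q with q ℚP.≟ 0ℚ
... | yes q≡0 = ⊥-elim (ℚP.<-irrefl refl (subst (0ℚ ℚ.<_) q≡0 (ℚP.positive⁻¹ q)))
... | no  q≢0 = ℚP.<⇒≤ (subst (0ℚ ℚ.<_) (sym (ℚP.*-identityˡ q⁻¹))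
                          (ℚP.positive⁻¹ _ {{ℚP.1/pos⇒pos q}}))
  where q⁻¹ = (ℚ.1/ q) {{ℚ.≢-nonZero q≢0}}

ℕtoℚ-mkℚ : ∀ n → ℕtoℚ n ≡ mkℚ (ℤ.+ n) 0 (Cop.sym (Cop.1-coprimeTo n))
ℕtoℚ-mkℚ n = ℚP.normalize-coprime (Cop.sym (Cop.1-coprimeTo n))

ℕtoℚ-+ : ∀ m n → ℕtoℚ (m ℕ.+ n) ≡ ℕtoℚ m + ℕtoℚ n
ℕtoℚ-+ m n = ℚP.toℚᵘ-injective (ℚᵘP.≃-trans (ℚᵘP.≃-reflexive (toℚᵘ-ℕ (m ℕ.+ n)))
  (ℚᵘP.≃-trans sumᵘ (ℚᵘP.≃-sym (ℚᵘP.≃-trans (ℚP.toℚᵘ-homo-+ (ℕtoℚ m) (ℕtoℚ n))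
     (ℚᵘP.≃-reflexive (cong₂ ℚᵘ._+_ (toℚᵘ-ℕ m) (toℚᵘ-ℕ n)))))))
  where
  toℚᵘ-ℕ : ∀ n → ℚ.toℚᵘ (ℕtoℚ n) ≡ ℚᵘ.mkℚᵘ (ℤ.+ n) 0
  toℚᵘ-ℕ n = cong ℚ.toℚᵘ (ℕtoℚ-mkℚ n)
  sumᵘ : ℚᵘ.mkℚᵘ (ℤ.+ (m ℕ.+ n)) 0 ℚᵘ.≃ (ℚᵘ.mkℚᵘ (ℤ.+ m) 0 ℚᵘ.+ ℚᵘ.mkℚᵘ (ℤ.+ n) 0)
  sumᵘ = ℚᵘ.*≡* (trans (ℤP.*-identityʳ _) (sym (trans (ℤP.*-identityʳ _)
           (cong₂ ℤ._+_ (ℤP.*-identityʳ (ℤ.+ m)) (ℤP.*-identityʳ (ℤ.+ n))))))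

ℕtoℚ-injective : ∀ m n → ℕtoℚ m ≡ ℕtoℚ n → m ≡ n
ℕtoℚ-injective m n eq = ℤP.+-injective (proj₁ (ℚP.mkℚ-injective
  (trans (sym (ℕtoℚ-mkℚ m)) (trans eq (ℕtoℚ-mkℚ n)))))

ℕtoℚ-nonneg : ∀ n → 0ℚ ≤ ℕtoℚ n
ℕtoℚ-nonneg n = ℚP.nonNegative⁻¹ (ℕtoℚ n) {{ℚP.normalize-nonNeg n 1}}

ℕtoℚ-∸ : ∀ m n → n ℕ.≤ m → ℕtoℚ (m ∸ n) ≡ ℕtoℚ m - ℕtoℚ n
ℕtoℚ-∸ m n n≤m = begin
  ℕtoℚ (m ∸ n)
    ≡⟨ solve 2 (λ a b → a := (a :+ b) :- b) refl (ℕtoℚ (m ∸ n)) (ℕtoℚ n) ⟩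
  (ℕtoℚ (m ∸ n) + ℕtoℚ n) - ℕtoℚ n
    ≡⟨ cong (_- ℕtoℚ n) (sym (ℕtoℚ-+ (m ∸ n) n)) ⟩
  ℕtoℚ (m ∸ n ℕ.+ n) - ℕtoℚ n
    ≡⟨ cong (λ k → ℕtoℚ k - ℕtoℚ n) (ℕP.m∸n+n≡m n≤m) ⟩
  ℕtoℚ m - ℕtoℚ n ∎
  where open ≡-Reasoning

recip-ℕ-nonneg : ∀ n → 0ℚ ≤ divℚ 1ℚ (ℕtoℚ n)
recip-ℕ-nonneg zero    = ℚP.≤-refl
recip-ℕ-nonneg (suc n) = recip-pos-nonneg (ℕtoℚ (suc n)) {{ℚP.normalize-pos (suc n) 1}}

indicator : Bool → ℚ
indicator b = if b then 1ℚ else 0ℚ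

indicator-idem : ∀ b → indicator b * indicator b ≡ indicator b
indicator-idem true  = refl
indicator-idem false = refl

indicator-∧ : ∀ a b → indicator a * indicator b ≡ indicator (a ∧ b)
indicator-∧ true  true  = refl
indicator-∧ true  false = refl
indicator-∧ false b     = ℚP.*-zeroˡ (indicator b)

count-sum : ∀ n (f : Fin n → Bool) → ℕtoℚ (count n f) ≡ sumℚ n (λ i → indicator (f i))
count-sum zero    f = refl
count-sum (suc n) f = trans (ℕtoℚ-+ (if f zero then 1 else 0) (count n (λ i → f (suc i))))
  (cong₂ _+_ (bit (f zero)) (count-sum n (λ i → f (suc i))))
  where
  bit : ∀ b → ℕtoℚ (if b then 1 else 0) ≡ indicator b
  bit true  = refl
  bit false = refl

count-≤ : ∀ n (f : Fin n → Bool) → count n f ℕ.≤ n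
count-≤ zero    f = ℕ.z≤n
count-≤ (suc n) f with f zero
... | true  = ℕ.s≤s (count-≤ n _)
... | false = ℕP.m≤n⇒m≤1+n (count-≤ n _)

Symmetric : ∀ {n} → Mat n → Set
Symmetric M = ∀ i j → M i j ≡ M j i

idMat-sym : ∀ {n} → Symmetric (idMat {n})
idMat-sym {suc n} zero    zero    = refl
idMat-sym {suc n} zero    (suc j) = refl
idMat-sym {suc n} (suc i) zero    = refl
idMat-sym {suc n} (suc i) (suc j) = idMat-sym i j

idMat-diag : ∀ {n} (i : Fin n) → idMat i i ≡ 1ℚ
idMat-diag {suc n} zero    = refl
idMat-diag {suc n} (suc i) = idMat-diag i

idMat-off : ∀ {n} (i j : Fin n) → i ≢ j → idMat i j ≡ 0ℚ
idMat-off {suc n} zero    zero    i≢j = ⊥-elim (i≢j refl)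
idMat-off {suc n} zero    (suc j) i≢j = refl
idMat-off {suc n} (suc i) zero    i≢j = refl
idMat-off {suc n} (suc i) (suc j) i≢j = idMat-off i j (λ i≡j → i≢j (cong suc i≡j))

sum-δʳ : ∀ n (f : Fin n → ℚ) (i : Fin n) → sumℚ n (λ j → f j * idMat j i) ≡ f i
sum-δʳ (suc n) f zero = begin
  f zero * 1ℚ + sumℚ n (λ j → f (suc j) * 0ℚ)
    ≡⟨ cong₂ _+_ (ℚP.*-identityʳ (f zero))
                 (trans (sum-cong n (λ j → ℚP.*-zeroʳ (f (suc j)))) (sum-zero n)) ⟩
  f zero + 0ℚ  ≡⟨ ℚP.+-identityʳ _ ⟩
  f zero       ∎
  where open ≡-Reasoning
sum-δʳ (suc n) f (suc i) = begin
  f zero * 0ℚ + sumℚ n (λ j → f (suc j) * idMat j i)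
    ≡⟨ cong₂ _+_ (ℚP.*-zeroʳ (f zero)) (sum-δʳ n (λ j → f (suc j)) i) ⟩
  0ℚ + f (suc i)  ≡⟨ ℚP.+-identityˡ _ ⟩
  f (suc i)       ∎
  where open ≡-Reasoning

sum-δˡ : ∀ n (f : Fin n → ℚ) (i : Fin n) → sumℚ n (λ j → idMat i j * f j) ≡ f i
sum-δˡ n f i = trans
  (sum-cong n (λ j → trans (ℚP.*-comm (idMat i j) (f j)) (cong (f j *_) (idMat-sym i j))))
  (sum-δʳ n f i)

diag-sym : ∀ {n} (f : Fin n → ℚ) → Symmetric (diag f)
diag-sym f i j with i F.≟ j
... | yes refl = refl
... | no  i≢j  = trans (cong (f i *_) (idMat-off i j i≢j)) (trans (ℚP.*-zeroʳ (f i))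
    (sym (trans (cong (f j *_) (idMat-off j i (λ j≡i → i≢j (sym j≡i)))) (ℚP.*-zeroʳ (f j)))))

diag-⊗ : ∀ {n} (f : Fin n → ℚ) (M : Mat n) i j → (diag f ⊗ M) i j ≡ f i * M i j
diag-⊗ {n} f M i j =
  trans (sum-cong n (λ k → ℚP.*-assoc (f i) (idMat i k) (M k j)))
        (trans (sum-*ˡ n (f i) _) (cong (f i *_) (sum-δˡ n (λ k → M k j) i)))

≈M-trans : ∀ {n} {M N K : Mat n} → M ≈M N → N ≈M K → M ≈M K
≈M-trans M≈N N≈K i j = trans (M≈N i j) (N≈K i j)

≈M-sym : ∀ {n} {M N : Mat n} → M ≈M N → N ≈M M
≈M-sym M≈N i j = sym (M≈N i j)

⊗-congʳ : ∀ {n} (M : Mat n) {N N′ : Mat n} → N ≈M N′ → M ⊗ N ≈M M ⊗ N′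
⊗-congʳ {n} M N≈N′ i j = sum-cong n (λ k → cong (M i k *_) (N≈N′ k j))

⊗-congˡ : ∀ {n} {M M′ : Mat n} (N : Mat n) → M ≈M M′ → M ⊗ N ≈M M′ ⊗ N
⊗-congˡ {n} N M≈M′ i j = sum-cong n (λ k → cong (_* N k j) (M≈M′ i k))

⊗-identityˡ : ∀ {n} (M : Mat n) → idMat ⊗ M ≈M M
⊗-identityˡ {n} M i j = sum-δˡ n (λ k → M k j) i

⊗-assoc : ∀ {n} (M N K : Mat n) → (M ⊗ N) ⊗ K ≈M M ⊗ (N ⊗ K)
⊗-assoc {n} M N K i j = begin
  sumℚ n (λ k → sumℚ n (λ l → M i l * N l k) * K k j)
    ≡⟨ sum-cong n (λ k → sym (sum-*ʳ n (K k j) (λ l → M i l * N l k))) ⟩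
  sumℚ n (λ k → sumℚ n (λ l → M i l * N l k * K k j))
    ≡⟨ sum-swap n n _ ⟩
  sumℚ n (λ l → sumℚ n (λ k → M i l * N l k * K k j))
    ≡⟨ sum-cong n (λ l → trans (sum-cong n (λ k → ℚP.*-assoc (M i l) (N l k) (K k j)))
                               (sum-*ˡ n (M i l) (λ k → N l k * K k j))) ⟩
  sumℚ n (λ l → M i l * sumℚ n (λ k → N l k * K k j)) ∎
  where open ≡-Reasoning

trace : ∀ {n} → Mat n → ℚ
trace {n} M = sumℚ n (λ i → M i i)

trace-comm : ∀ {n} (M N : Mat n) → trace (M ⊗ N) ≡ trace (N ⊗ M)
trace-comm {n} M N = trans (sum-swap n n (λ i k → M i k * N k i))
  (sum-cong n (λ k → sum-cong n (λ i → ℚP.*-comm (M i k) (N k i))))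

-- A product of two symmetric matrices is the transpose of the reversed
-- product; so if MN = I for symmetric M, N then also NM = I.
symmetric-inverse-comm : ∀ {n} (M N : Mat n) → Symmetric M → Symmetric N →
  M ⊗ N ≈M idMat → N ⊗ M ≈M idMat
symmetric-inverse-comm {n} M N M-sym N-sym MN≈I i j = begin
  sumℚ n (λ k → N i k * M k j)
    ≡⟨ sum-cong n (λ k → trans (ℚP.*-comm (N i k) (M k j))
                              (cong₂ _*_ (M-sym k j) (N-sym i k))) ⟩
  (M ⊗ N) j i  ≡⟨ MN≈I j i ⟩
  idMat j i    ≡⟨ idMat-sym j i ⟩
  idMat i j    ∎
  where open ≡-Reasoning

sandwich-sym : ∀ {n} (A N : Mat n) → Symmetric N → Symmetric (A ⊗ (N ⊗ transpose A))
sandwich-sym {n} A N N-sym i j = begin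
  sumℚ n (λ k → A i k * sumℚ n (λ l → N k l * A j l))
    ≡⟨ sum-cong n (λ k → sym (sum-*ˡ n (A i k) (λ l → N k l * A j l))) ⟩
  sumℚ n (λ k → sumℚ n (λ l → A i k * (N k l * A j l)))
    ≡⟨ sum-swap n n _ ⟩
  sumℚ n (λ l → sumℚ n (λ k → A i k * (N k l * A j l)))
    ≡⟨ sum-cong n (λ l → sum-cong n (λ k → trans (cong (λ z → A i k * (z * A j l)) (N-sym k l))
          (solve 3 (λ a m b → a :* (m :* b) := b :* (m :* a)) refl (A i k) (N l k) (A j l)))) ⟩
  sumℚ n (λ l → sumℚ n (λ k → A j l * (N l k * A i k)))
    ≡⟨ sum-cong n (λ l → sum-*ˡ n (A j l) (λ k → N l k * A i k)) ⟩
  sumℚ n (λ l → A j l * sumℚ n (λ k → N l k * A i k)) ∎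
  where open ≡-Reasoning

-- A symmetric idempotent rational matrix with the trace of the identity is
-- the identity: Σᵢⱼ (Pᵢⱼ − Iᵢⱼ)² = Σᵢ (Iᵢᵢ − Pᵢᵢ) = tr I − tr P = 0.
symmetric-idempotent⇒identity : ∀ {n} (P : Mat n) → Symmetric P → P ⊗ P ≈M P →
  trace P ≡ trace (idMat {n}) → P ≈M idMat
symmetric-idempotent⇒identity {n} P P-sym PP≈P trP≡n i j =
  difference-zero (P i j) (idMat i j) (sq-zero _ (nonneg-sum-zero n _ (sq i) (rows-zero i) j))
  where
  open ≡-Reasoning

  I : Mat n
  I = idMat

  sq : ∀ i j → 0ℚ ≤ (P i j - idMat i j) * (P i j - idMat i j)
  sq i j = sq-nonneg (P i j - idMat i j)

  expand : ∀ p e → (p - e) * (p - e) ≡ p * p + (e * e - (e * p + e * p))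
  expand = solve 2 (λ p e → (p :- e) :* (p :- e) := p :* p :+ (e :* e :- (e :* p :+ e :* p))) refl

  row-sq : ∀ i → sumℚ n (λ j → (P i j - idMat i j) * (P i j - idMat i j)) ≡ idMat i i - P i i
  row-sq i = begin
    sumℚ n (λ j → (P i j - idMat i j) * (P i j - idMat i j))
      ≡⟨ trans (sum-cong n (λ j → expand (P i j) (idMat i j))) (sum-+ n _ _) ⟩
    sumℚ n (λ j → P i j * P i j)
      + sumℚ n (λ j → idMat i j * idMat i j - (idMat i j * P i j + idMat i j * P i j))
      ≡⟨ cong₂ _+_ (trans (sum-cong n (λ j → cong (P i j *_) (P-sym i j))) (PP≈P i i))
           (trans (sum-- n _ _) (cong₂ _-_ (sum-δˡ n (idMat i) i)
             (trans (sum-+ n _ _) (cong₂ _+_ (sum-δˡ n (P i) i) (sum-δˡ n (P i) i))))) ⟩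
    P i i + (idMat i i - (P i i + P i i))
      ≡⟨ solve 2 (λ p e → p :+ (e :- (p :+ p)) := e :- p) refl (P i i) (idMat i i) ⟩
    idMat i i - P i i ∎

  rows-zero : ∀ i → sumℚ n (λ j → (P i j - idMat i j) * (P i j - idMat i j)) ≡ 0ℚ
  rows-zero = nonneg-sum-zero n _ (λ i → sum-nonneg n _ (sq i)) (begin
    sumℚ n (λ i → sumℚ n (λ j → (P i j - idMat i j) * (P i j - idMat i j)))
      ≡⟨ trans (sum-cong n row-sq) (sum-- n _ _) ⟩
    trace I - trace P  ≡⟨ cong (λ w → trace I - w) trP≡n ⟩
    trace I - trace I  ≡⟨ ℚP.+-inverseʳ (trace I) ⟩
    0ℚ ∎)

left-inverse⇒right-inverse : ∀ {n} (A G : Mat n) → G ⊗ A ≈M idMat →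
  Symmetric (A ⊗ G) → A ⊗ G ≈M idMat
left-inverse⇒right-inverse {n} A G GA≈I AG-sym =
  symmetric-idempotent⇒identity (A ⊗ G) AG-sym idempotent
    (trans (trace-comm A G) (sum-cong n (λ i → GA≈I i i)))
  where
  idempotent : (A ⊗ G) ⊗ (A ⊗ G) ≈M A ⊗ G
  idempotent = ≈M-trans (⊗-assoc A G (A ⊗ G)) (⊗-congʳ A (≈M-trans
    (≈M-sym (⊗-assoc G A G)) (≈M-trans (⊗-congˡ G GA≈I) (⊗-identityˡ G))))

-- Sherman–Morrison for a diagonal matrix plus a constant matrix:
-- K = diag δ + λJ.
module ShermanMorrison {n : ℕ} (δ d : Fin n → ℚ) (dδ≡1 : ∀ i → d i * δ i ≡ 1ℚ)
                       (λq c₀ : ℚ) (c₀s≡λ : c₀ * (1ℚ + λq * sumℚ n d) ≡ λq) where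

  s : ℚ
  s = 1ℚ + λq * sumℚ n d

  K : Mat n
  K i j = δ i * idMat i j + λq

  N : Mat n
  N i j = d i * idMat i j - c₀ * (d i * d j)

  K-sym : Symmetric K
  K-sym i j = cong (_+ λq) (diag-sym δ i j)

  N-sym : Symmetric N
  N-sym i j = cong₂ _-_ (diag-sym d i j) (cong (c₀ *_) (ℚP.*-comm (d i) (d j)))

  K-d : ∀ i → sumℚ n (λ j → K i j * d j) ≡ s
  K-d i = begin
    sumℚ n (λ j → (δ i * idMat i j + λq) * d j)
      ≡⟨ sum-cong n (λ j → solve 4 (λ a e l b → (a :* e :+ l) :* b := a :* (e :* b) :+ l :* b)
                                   refl (δ i) (idMat i j) λq (d j)) ⟩
    sumℚ n (λ j → δ i * (idMat i j * d j) + λq * d j)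
      ≡⟨ trans (sum-+ n _ _) (cong₂ _+_ (trans (sum-*ˡ n (δ i) _) (cong (δ i *_) (sum-δˡ n d i)))
                                        (sum-*ˡ n λq d)) ⟩
    δ i * d i + λq * sumℚ n d
      ≡⟨ cong (_+ λq * sumℚ n d) (trans (ℚP.*-comm (δ i) (d i)) (dδ≡1 i)) ⟩
    s ∎
    where open ≡-Reasoning

  N-K : N ⊗ K ≈M idMat
  N-K i k = begin
    sumℚ n (λ j → (d i * idMat i j - c₀ * (d i * d j)) * K j k)
      ≡⟨ sum-cong n (λ j → solve 5 (λ a e c b m → (a :* e :- c :* (a :* b)) :* m
                                                := a :* (e :* m) :- (c :* a) :* (b :* m))
                                   refl (d i) (idMat i j) c₀ (d j) (K j k)) ⟩
    sumℚ n (λ j → d i * (idMat i j * K j k) - (c₀ * d i) * (d j * K j k))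
      ≡⟨ trans (sum-- n _ _)
           (cong₂ _-_ (trans (sum-*ˡ n (d i) _) (cong (d i *_) (sum-δˡ n (λ j → K j k) i)))
                      (trans (sum-*ˡ n (c₀ * d i) _) (cong (c₀ * d i *_) dK≡s))) ⟩
    d i * (δ i * idMat i k + λq) - c₀ * d i * s
      ≡⟨ solve 6 (λ a b e l c t → a :* (b :* e :+ l) :- c :* a :* t
                                := (a :* b) :* e :+ a :* (l :- c :* t))
                 refl (d i) (δ i) (idMat i k) λq c₀ s ⟩
    (d i * δ i) * idMat i k + d i * (λq - c₀ * s)
      ≡⟨ cong₂ (λ a b → a * idMat i k + d i * (λq - b)) (dδ≡1 i) c₀s≡λ ⟩
    1ℚ * idMat i k + d i * (λq - λq)
      ≡⟨ solve 3 (λ e a l → con 1ℚ :* e :+ a :* (l :- l) := e) refl (idMat i k) (d i) λq ⟩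
    idMat i k ∎
    where
    open ≡-Reasoning
    dK≡s : sumℚ n (λ j → d j * K j k) ≡ s
    dK≡s = trans (sum-cong n (λ j → trans (ℚP.*-comm (d j) (K j k)) (cong (_* d j) (K-sym j k))))
                 (K-d k)

module RyserGram {v : ℕ} {inc : Incidence v} {λ′ : ℕ} (D : IsRyserDesign v inc λ′) where
  open IsRyserDesign D

  A : Mat v
  A = incMat inc

  λq : ℚ
  λq = ℕtoℚ λ′

  δ : Fin v → ℚ
  δ b = ℕtoℚ (blockSize inc b ∸ λ′)

  d : Fin v → ℚ
  d b = divℚ 1ℚ (δ b)

  Δ⁻¹ : Mat v
  Δ⁻¹ = diag d

  -- Every block is larger than λ, so Δ is invertible.
  δ≢0 : ∀ b → δ b ≢ 0ℚ
  δ≢0 b δb≡0 = ℕP.<⇒≱ (bigBlocks b) (ℕP.m∸n≡0⇒m≤n (ℕtoℚ-injective _ 0 δb≡0))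

  dδ≡1 : ∀ b → d b * δ b ≡ 1ℚ
  dδ≡1 b = divℚ-spec 1ℚ (δ b) (δ≢0 b)

  column-sum : ∀ b → sumℚ v (λ p → A p b) ≡ δ b + λq
  column-sum b = begin
    sumℚ v (λ p → A p b)                          ≡⟨ sym (count-sum v (λ p → inc p b)) ⟩
    ℕtoℚ (blockSize inc b)                        ≡⟨ cong ℕtoℚ (sym (ℕP.m∸n+n≡m (ℕP.<⇒≤ (bigBlocks b)))) ⟩
    ℕtoℚ (blockSize inc b ∸ λ′ ℕ.+ λ′)            ≡⟨ ℕtoℚ-+ (blockSize inc b ∸ λ′) λ′ ⟩
    δ b + λq                                      ∎
    where open ≡-Reasoning

  row-sum : ∀ p → sumℚ v (A p) ≡ ℕtoℚ (replication inc p)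
  row-sum p = sym (count-sum v (inc p))

  s : ℚ
  s = 1ℚ + λq * sumℚ v d

  s≢0 : s ≢ 0ℚ
  s≢0 s≡0 = 1≢0 (nonneg-+-zero 1ℚ (λq * sumℚ v d) (ℚP.nonNegative⁻¹ 1ℚ) λΣd≥0 s≡0)
    where
    λΣd≥0 : 0ℚ ≤ λq * sumℚ v d
    λΣd≥0 = ℚP.nonNegative⁻¹ _
      {{ℚP.nonNeg*nonNeg⇒nonNeg λq {{ℚ.nonNegative (ℕtoℚ-nonneg λ′)}}
          (sumℚ v d) {{ℚ.nonNegative (sum-nonneg v d (λ b → recip-ℕ-nonneg (blockSize inc b ∸ λ′)))}}}}

  c₀ : ℚ
  c₀ = divℚ λq s

  c₀s≡λ : c₀ * s ≡ λq
  c₀s≡λ = divℚ-spec λq s s≢0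

  open ShermanMorrison δ d dδ≡1 λq c₀ c₀s≡λ using (K; N; N-sym; K-d; N-K)

  gram : transpose A ⊗ A ≈M K
  gram b b′ with b F.≟ b′
  ... | yes refl = begin
    sumℚ v (λ p → A p b * A p b)  ≡⟨ sum-cong v (λ p → indicator-idem (inc p b)) ⟩
    sumℚ v (λ p → A p b)          ≡⟨ column-sum b ⟩
    δ b + λq                      ≡⟨ cong (_+ λq) (sym (trans (cong (δ b *_) (idMat-diag b))
                                                             (ℚP.*-identityʳ (δ b)))) ⟩
    δ b * idMat b b + λq          ∎
    where open ≡-Reasoning
  ... | no b≢b′ = begin
    sumℚ v (λ p → A p b * A p b′)
      ≡⟨ sum-cong v (λ p → indicator-∧ (inc p b) (inc p b′)) ⟩
    sumℚ v (λ p → indicator (inc p b ∧ inc p b′))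
      ≡⟨ sym (count-sum v _) ⟩
    ℕtoℚ (count v (λ p → inc p b ∧ inc p b′))
      ≡⟨ cong ℕtoℚ (meet b b′ b≢b′) ⟩
    λq
      ≡⟨ sym (ℚP.+-identityˡ λq) ⟩
    0ℚ + λq
      ≡⟨ cong (_+ λq) (sym (trans (cong (δ b *_) (idMat-off b b′ b≢b′)) (ℚP.*-zeroʳ (δ b)))) ⟩
    δ b * idMat b b′ + λq ∎
    where open ≡-Reasoning

  -- Step 2: G = NAᵀ is a left inverse of A, and a right inverse because
  -- AG = ANAᵀ is symmetric.
  G : Mat v
  G = N ⊗ transpose A

  G-left : G ⊗ A ≈M idMat
  G-left = ≈M-trans (⊗-assoc N (transpose A) A) (≈M-trans (⊗-congʳ N gram) N-K)

  G-right : A ⊗ G ≈M idMat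
  G-right = left-inverse⇒right-inverse A G G-left (sandwich-sym A N N-sym)

  x : Fin v → ℚ
  x p = sumℚ v (λ b → A p b * d b)

  G-entry : ∀ b q → G b q ≡ d b * A q b - (c₀ * x q) * d b
  G-entry b q = begin
    sumℚ v (λ l → (d b * idMat b l - c₀ * (d b * d l)) * A q l)
      ≡⟨ sum-cong v (λ l → solve 5 (λ a e c b′ m → (a :* e :- c :* (a :* b′)) :* m
                                                 := a :* (e :* m) :- (c :* a) :* (m :* b′))
                                   refl (d b) (idMat b l) c₀ (d l) (A q l)) ⟩
    sumℚ v (λ l → d b * (idMat b l * A q l) - (c₀ * d b) * (A q l * d l))
      ≡⟨ trans (sum-- v _ _) (cong₂ _-_ (trans (sum-*ˡ v (d b) _) (cong (d b *_) (sum-δˡ v (A q) b)))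
                                         (sum-*ˡ v (c₀ * d b) _)) ⟩
    d b * A q b - (c₀ * d b) * x q
      ≡⟨ cong (λ w → d b * A q b - w) (solve 3 (λ c a y → (c :* a) :* y := (c :* y) :* a) refl c₀ (d b) (x q)) ⟩
    d b * A q b - (c₀ * x q) * d b ∎
    where open ≡-Reasoning

  Δ⁻¹Aᵀ-entry : ∀ b q → (Δ⁻¹ ⊗ transpose A) b q ≡ G b q + (c₀ * x q) * d b
  Δ⁻¹Aᵀ-entry b q = trans (diag-⊗ d (transpose A) b q) (sym (begin
    G b q + (c₀ * x q) * d b                        ≡⟨ cong (_+ (c₀ * x q) * d b) (G-entry b q) ⟩
    (d b * A q b - (c₀ * x q) * d b) + (c₀ * x q) * d b
      ≡⟨ solve 2 (λ a y → (a :- y) :+ y := a) refl (d b * A q b) ((c₀ * x q) * d b) ⟩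
    d b * A q b                                     ∎))
    where open ≡-Reasoning

  -- AΔ⁻¹Aᵀ = AG + c₀xxᵀ = I + c₀xxᵀ.
  AΔ⁻¹Aᵀ : ∀ p q → (A ⊗ (Δ⁻¹ ⊗ transpose A)) p q ≡ idMat p q + c₀ * (x p * x q)
  AΔ⁻¹Aᵀ p q = begin
    sumℚ v (λ b → A p b * (Δ⁻¹ ⊗ transpose A) b q)
      ≡⟨ sum-cong v (λ b → trans (cong (A p b *_) (Δ⁻¹Aᵀ-entry b q))
           (solve 4 (λ a g y e → a :* (g :+ y :* e) := a :* g :+ y :* (a :* e))
                    refl (A p b) (G b q) (c₀ * x q) (d b))) ⟩
    sumℚ v (λ b → A p b * G b q + (c₀ * x q) * (A p b * d b))
      ≡⟨ trans (sum-+ v _ _) (cong₂ _+_ (G-right p q) (sum-*ˡ v (c₀ * x q) _)) ⟩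
    idMat p q + (c₀ * x q) * x p
      ≡⟨ cong (idMat p q +_) (solve 3 (λ c a b → (c :* b) :* a := c :* (a :* b)) refl c₀ (x p) (x q)) ⟩
    idMat p q + c₀ * (x p * x q) ∎
    where open ≡-Reasoning

  -- The diagonal of AΔ⁻¹Aᵀ: since A is a 0/1 matrix, xₚ = 1 + c₀xₚ².
  x-quadratic : ∀ p → x p ≡ 1ℚ + c₀ * (x p * x p)
  x-quadratic p = begin
    sumℚ v (λ b → A p b * d b)
      ≡⟨ sum-cong v (λ b → trans (cong (_* d b) (sym (indicator-idem (inc p b))))
           (trans (solve 3 (λ a a′ e → a :* a′ :* e := a :* (e :* a′)) refl (A p b) (A p b) (d b))
                  (cong (A p b *_) (sym (diag-⊗ d (transpose A) b p))))) ⟩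
    (A ⊗ (Δ⁻¹ ⊗ transpose A)) p p  ≡⟨ AΔ⁻¹Aᵀ p p ⟩
    idMat p p + c₀ * (x p * x p)   ≡⟨ cong (_+ c₀ * (x p * x p)) (idMat-diag p) ⟩
    1ℚ + c₀ * (x p * x p)          ∎
    where open ≡-Reasoning

  -- The row sums of AΔ⁻¹Aᵀ are rₚ + λxₚ, since every block b has kᵦ = δᵦ + λ.
  AΔ⁻¹Aᵀ-row-sum : ∀ p → sumℚ v ((A ⊗ (Δ⁻¹ ⊗ transpose A)) p) ≡ ℕtoℚ (replication inc p) + λq * x p
  AΔ⁻¹Aᵀ-row-sum p = begin
    sumℚ v (λ q → sumℚ v (λ b → A p b * (Δ⁻¹ ⊗ transpose A) b q))
      ≡⟨ sum-swap v v _ ⟩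
    sumℚ v (λ b → sumℚ v (λ q → A p b * (Δ⁻¹ ⊗ transpose A) b q))
      ≡⟨ sum-cong v (λ b → trans (sum-cong v (λ q → trans (cong (A p b *_) (diag-⊗ d (transpose A) b q))
                                                           (sym (ℚP.*-assoc (A p b) (d b) (A q b)))))
                                 (sum-*ˡ v (A p b * d b) (λ q → A q b))) ⟩
    sumℚ v (λ b → (A p b * d b) * sumℚ v (λ q → A q b))
      ≡⟨ sum-cong v (λ b → trans (cong (A p b * d b *_) (column-sum b))
           (solve 4 (λ a e k l → (a :* e) :* (k :+ l) := a :* (e :* k) :+ l :* (a :* e))
                    refl (A p b) (d b) (δ b) λq)) ⟩
    sumℚ v (λ b → A p b * (d b * δ b) + λq * (A p b * d b))
      ≡⟨ trans (sum-+ v _ _) (cong₂ _+_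
           (trans (sum-cong v (λ b → trans (cong (A p b *_) (dδ≡1 b)) (ℚP.*-identityʳ (A p b))))
                  (row-sum p))
           (sum-*ˡ v λq _)) ⟩
    ℕtoℚ (replication inc p) + λq * x p ∎
    where open ≡-Reasoning

  t : ℚ
  t = c₀ * sumℚ v x - λq

  -- Comparing with the row sums of I + c₀xxᵀ: rₚ − 1 = t·xₚ.
  replication-linear : ∀ p → ℕtoℚ (replication inc p) - 1ℚ ≡ t * x p
  replication-linear p = begin
    r - 1ℚ
      ≡⟨ solve 3 (λ r l y → r :- con 1ℚ := (r :+ l :* y) :- (con 1ℚ :+ l :* y)) refl r λq (x p) ⟩
    (r + λq * x p) - (1ℚ + λq * x p)
      ≡⟨ cong (_- (1ℚ + λq * x p)) (trans (sym (AΔ⁻¹Aᵀ-row-sum p)) row-sum-I+c₀xxᵀ) ⟩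
    (1ℚ + c₀ * (x p * X)) - (1ℚ + λq * x p)
      ≡⟨ solve 4 (λ l y c X′ → (con 1ℚ :+ c :* (y :* X′)) :- (con 1ℚ :+ l :* y) := (c :* X′ :- l) :* y)
                 refl λq (x p) c₀ X ⟩
    t * x p ∎
    where
    open ≡-Reasoning
    r = ℕtoℚ (replication inc p)
    X = sumℚ v x
    row-sum-I+c₀xxᵀ : sumℚ v ((A ⊗ (Δ⁻¹ ⊗ transpose A)) p) ≡ 1ℚ + c₀ * (x p * X)
    row-sum-I+c₀xxᵀ = trans (sum-cong v (AΔ⁻¹Aᵀ p)) (trans (sum-+ v _ _) (cong₂ _+_
      (trans (sum-cong v (λ q → sym (ℚP.*-identityʳ (idMat p q)))) (sum-δˡ v (λ _ → 1ℚ) p))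
      (trans (sum-*ˡ v c₀ _) (cong (c₀ *_) (sum-*ˡ v (x p) x)))))

  -- Used in step 4: Aᵀx = AᵀAd = Kd is the constant vector s.
  Aᵀx : ∀ b → sumℚ v (λ l → A l b * x l) ≡ s
  Aᵀx b = begin
    sumℚ v (λ l → A l b * sumℚ v (λ b′ → A l b′ * d b′))
      ≡⟨ sum-cong v (λ l → sym (sum-*ˡ v (A l b) _)) ⟩
    sumℚ v (λ l → sumℚ v (λ b′ → A l b * (A l b′ * d b′)))
      ≡⟨ sum-swap v v _ ⟩
    sumℚ v (λ b′ → sumℚ v (λ l → A l b * (A l b′ * d b′)))
      ≡⟨ sum-cong v (λ b′ → trans (sum-cong v (λ l → sym (ℚP.*-assoc (A l b) (A l b′) (d b′))))
                                  (sum-*ʳ v (d b′) _)) ⟩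
    sumℚ v (λ b′ → (transpose A ⊗ A) b b′ * d b′)
      ≡⟨ sum-cong v (λ b′ → cong (_* d b′) (gram b b′)) ⟩
    sumℚ v (λ b′ → K b b′ * d b′)
      ≡⟨ K-d b ⟩
    s ∎
    where open ≡-Reasoning

blockwise : ∀ {B : Set} e₁ {e₂} → B → B → Fin (e₁ ℕ.+ e₂) → B
blockwise e₁ a b p = Data.Sum.[_,_] (λ _ → a) (λ _ → b) (splitAt e₁ p)

blockwise-map : ∀ {B C : Set} e₁ {e₂} (g : B → C) (a b : B) (p : Fin (e₁ ℕ.+ e₂)) →
  g (blockwise e₁ a b p) ≡ blockwise e₁ (g a) (g b) p
blockwise-map e₁ g a b p with splitAt e₁ p
... | inj₁ _ = refl
... | inj₂ _ = refl

blockwise-first : ∀ {B : Set} e₁ e₂ (a b : B) (i : Fin e₁) → blockwise e₁ a b (i ↑ˡ e₂) ≡ a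
blockwise-first e₁ e₂ a b i = cong (Data.Sum.[_,_] (λ _ → a) (λ _ → b)) (FP.splitAt-↑ˡ e₁ i e₂)

blockwise-second : ∀ {B : Set} e₁ e₂ (a b : B) (j : Fin e₂) → blockwise e₁ a b (e₁ ↑ʳ j) ≡ b
blockwise-second e₁ e₂ a b j = cong (Data.Sum.[_,_] (λ _ → a) (λ _ → b)) (FP.splitAt-↑ʳ e₁ e₂ j)

vieta : ∀ c y z → y ≢ z → y ≡ 1ℚ + c * (y * y) → z ≡ 1ℚ + c * (z * z) →
  c * (y + z) ≡ 1ℚ × c * (y * z) ≡ 1ℚ
vieta c y z y≢z y-root z-root = sum-relation , product-relation
  where
  open ≡-Reasoning

  root : ∀ w → w ≡ 1ℚ + c * (w * w) → w - c * (w * w) ≡ 1ℚ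
  root w w-root = trans (cong (_- c * (w * w)) w-root)
                        (solve 1 (λ u → (con 1ℚ :+ u) :- u := con 1ℚ) refl (c * (w * w)))

  factored : (y - z) * (1ℚ - c * (y + z)) ≡ 0ℚ
  factored = trans
    (solve 3 (λ y z c → (y :- z) :* (con 1ℚ :- c :* (y :+ z))
                      := (y :- c :* (y :* y)) :- (z :- c :* (z :* z))) refl y z c)
    (trans (cong₂ _-_ (root y y-root) (root z z-root)) (ℚP.+-inverseʳ 1ℚ))

  sum-relation : c * (y + z) ≡ 1ℚ
  sum-relation = sym (difference-zero 1ℚ _ (*-zero-cancelˡ (y - z) _ y-z≢0 factored))
    where y-z≢0 = λ y-z≡0 → y≢z (difference-zero y z y-z≡0)

  product-relation : c * (y * z) ≡ 1ℚ
  product-relation = begin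
    c * (y * z)
      ≡⟨ solve 3 (λ y z c → c :* (y :* z) := y :* (c :* (y :+ z)) :- c :* (y :* y)) refl y z c ⟩
    y * (c * (y + z)) - c * (y * y)  ≡⟨ cong (λ w → y * w - c * (y * y)) sum-relation ⟩
    y * 1ℚ - c * (y * y)             ≡⟨ cong (_- c * (y * y)) (ℚP.*-identityʳ y) ⟩
    y - c * (y * y)                  ≡⟨ root y y-root ⟩
    1ℚ                               ∎

Rmat-rank-one : ∀ e₁ e₂ (ρ c y₁ y₂ : ℚ) →
  ρ ≡ c * (y₁ * y₁) → 1ℚ ≡ c * (y₁ * y₂) → divℚ 1ℚ ρ ≡ c * (y₂ * y₂) →
  ∀ i j → Rmat e₁ e₂ ρ i j ≡ c * (blockwise e₁ y₁ y₂ i * blockwise e₁ y₁ y₂ j)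
Rmat-rank-one e₁ e₂ ρ c y₁ y₂ ρ≡cy₁² 1≡cy₁y₂ ρ⁻¹≡cy₂² i j with splitAt e₁ i | splitAt e₁ j
... | inj₁ _ | inj₁ _ = ρ≡cy₁²
... | inj₁ _ | inj₂ _ = 1≡cy₁y₂
... | inj₂ _ | inj₁ _ = trans 1≡cy₁y₂ (cong (c *_) (ℚP.*-comm y₁ y₂))
... | inj₂ _ | inj₂ _ = ρ⁻¹≡cy₂²

module RyserTwoClasses {e₁ e₂ : ℕ} {inc : Incidence (e₁ ℕ.+ e₂)} {λ′ r₁ r₂ : ℕ}
  (D : IsRyserDesign (e₁ ℕ.+ e₂) inc λ′)
  (r₂<r₁ : r₂ < r₁) (r₁+r₂≡v+1 : r₁ ℕ.+ r₂ ≡ suc (e₁ ℕ.+ e₂)) (0<e₁ : 0 < e₁) (0<e₂ : 0 < e₂)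
  (replication-classes : ∀ p → replication inc p ≡ blockwise e₁ r₁ r₂ p) where

  open RyserGram D
  open ≡-Reasoning

  p₁ p₂ : Fin (e₁ ℕ.+ e₂)
  p₁ = F.fromℕ< 0<e₁ ↑ˡ e₂
  p₂ = e₁ ↑ʳ F.fromℕ< 0<e₂

  r[p₁]≡r₁ : replication inc p₁ ≡ r₁
  r[p₁]≡r₁ = trans (replication-classes p₁) (blockwise-first e₁ e₂ r₁ r₂ _)

  r[p₂]≡r₂ : replication inc p₂ ≡ r₂
  r[p₂]≡r₂ = trans (replication-classes p₂) (blockwise-second e₁ e₂ r₁ r₂ _)

  r₁≥1 : 1 ℕ.≤ r₁
  r₁≥1 = ℕP.<-≤-trans (ℕ.s≤s ℕ.z≤n) r₂<r₁

  -- r₁ ≤ v and r₁ + r₂ = v + 1 force r₂ ≥ 1.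
  r₂≥1 : 1 ℕ.≤ r₂
  r₂≥1 = ℕP.+-cancelˡ-≤ (e₁ ℕ.+ e₂) 1 r₂
    (subst (ℕ._≤ e₁ ℕ.+ e₂ ℕ.+ r₂) (trans r₁+r₂≡v+1 (ℕP.+-comm 1 (e₁ ℕ.+ e₂)))
           (ℕP.+-monoˡ-≤ r₂ r₁≤v))
    where
    r₁≤v : r₁ ℕ.≤ e₁ ℕ.+ e₂
    r₁≤v = subst (ℕ._≤ e₁ ℕ.+ e₂) r[p₁]≡r₁ (count-≤ (e₁ ℕ.+ e₂) (inc p₁))

  -- t ≠ 0: otherwise every point would lie in exactly one block, so r₁ = r₂.
  t≢0 : t ≢ 0ℚ
  t≢0 t≡0 = ℕP.<⇒≢ r₂<r₁ (ℕtoℚ-injective r₂ r₁ (begin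
    ℕtoℚ r₂                       ≡⟨ cong ℕtoℚ (sym r[p₂]≡r₂) ⟩
    ℕtoℚ (replication inc p₂)     ≡⟨ r≡1 p₂ ⟩
    1ℚ                            ≡⟨ sym (r≡1 p₁) ⟩
    ℕtoℚ (replication inc p₁)     ≡⟨ cong ℕtoℚ r[p₁]≡r₁ ⟩
    ℕtoℚ r₁                       ∎))
    where
    r≡1 : ∀ p → ℕtoℚ (replication inc p) ≡ 1ℚ
    r≡1 p = difference-zero _ _
      (trans (replication-linear p) (trans (cong (_* x p) t≡0) (ℚP.*-zeroˡ (x p))))

  -- Hence xₚ is a function φ of rₚ, and x is blockwise (x₁, x₂).
  φ : ℕ → ℚ
  φ r = divℚ (ℕtoℚ r - 1ℚ) t

  tφ : ∀ r → t * φ r ≡ ℕtoℚ r - 1ℚ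
  tφ r = trans (ℚP.*-comm t (φ r)) (divℚ-spec _ t t≢0)

  x₁ x₂ : ℚ
  x₁ = φ r₁
  x₂ = φ r₂

  x-classes : ∀ p → x p ≡ blockwise e₁ x₁ x₂ p
  x-classes p = begin
    x p
      ≡⟨ sym (divℚ-unique _ t (x p) t≢0 (trans (ℚP.*-comm (x p) t) (sym (replication-linear p)))) ⟩
    φ (replication inc p)      ≡⟨ cong φ (replication-classes p) ⟩
    φ (blockwise e₁ r₁ r₂ p)   ≡⟨ blockwise-map e₁ φ r₁ r₂ p ⟩
    blockwise e₁ x₁ x₂ p       ∎

  x₁≢x₂ : x₁ ≢ x₂
  x₁≢x₂ x₁≡x₂ = ℕP.<⇒≢ r₂<r₁ (sym (ℕtoℚ-injective r₁ r₂ (begin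
    ℕtoℚ r₁                ≡⟨ solve 1 (λ a → a := (a :- con 1ℚ) :+ con 1ℚ) refl (ℕtoℚ r₁) ⟩
    (ℕtoℚ r₁ - 1ℚ) + 1ℚ    ≡⟨ cong (_+ 1ℚ) (trans (sym (tφ r₁)) (trans (cong (t *_) x₁≡x₂) (tφ r₂))) ⟩
    (ℕtoℚ r₂ - 1ℚ) + 1ℚ    ≡⟨ solve 1 (λ a → (a :- con 1ℚ) :+ con 1ℚ := a) refl (ℕtoℚ r₂) ⟩
    ℕtoℚ r₂                ∎)))

  x₁-root : x₁ ≡ 1ℚ + c₀ * (x₁ * x₁)
  x₁-root = subst (λ w → w ≡ 1ℚ + c₀ * (w * w))
    (trans (x-classes p₁) (blockwise-first e₁ e₂ x₁ x₂ _)) (x-quadratic p₁)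

  x₂-root : x₂ ≡ 1ℚ + c₀ * (x₂ * x₂)
  x₂-root = subst (λ w → w ≡ 1ℚ + c₀ * (w * w))
    (trans (x-classes p₂) (blockwise-second e₁ e₂ x₁ x₂ _)) (x-quadratic p₂)

  c₀[x₁+x₂]≡1 : c₀ * (x₁ + x₂) ≡ 1ℚ
  c₀[x₁+x₂]≡1 = proj₁ (vieta c₀ x₁ x₂ x₁≢x₂ x₁-root x₂-root)

  c₀x₁x₂≡1 : c₀ * (x₁ * x₂) ≡ 1ℚ
  c₀x₁x₂≡1 = proj₂ (vieta c₀ x₁ x₂ x₁≢x₂ x₁-root x₂-root)

  factor≢0 : ∀ a b → a * b ≡ 1ℚ → a ≢ 0ℚ
  factor≢0 a b ab≡1 a≡0 = 1≢0 (trans (sym ab≡1) (trans (cong (_* b) a≡0) (ℚP.*-zeroˡ b)))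

  x₂≢0 : x₂ ≢ 0ℚ
  x₂≢0 = factor≢0 x₂ (c₀ * x₁)
    (trans (solve 3 (λ a b c → a :* (c :* b) := c :* (b :* a)) refl x₂ x₁ c₀) c₀x₁x₂≡1)

  ρ : ℚ
  ρ = divℚ (ℕtoℚ (r₁ ∸ 1)) (ℕtoℚ (r₂ ∸ 1))

  -- rᵢ − 1 = t·xᵢ, hence ρ = x₁/x₂.
  r∸1≡tφ : ∀ r → 1 ℕ.≤ r → ℕtoℚ (r ∸ 1) ≡ t * φ r
  r∸1≡tφ r 1≤r = trans (ℕtoℚ-∸ r 1 1≤r) (sym (tφ r))

  ρx₂≡x₁ : ρ * x₂ ≡ x₁
  ρx₂≡x₁ = *-cancelʳ _ _ t t≢0 (begin
    ρ * x₂ * t         ≡⟨ solve 3 (λ a b c → a :* b :* c := a :* (c :* b)) refl ρ x₂ t ⟩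
    ρ * (t * x₂)       ≡⟨ cong (ρ *_) (sym (r∸1≡tφ r₂ r₂≥1)) ⟩
    ρ * ℕtoℚ (r₂ ∸ 1)  ≡⟨ divℚ-spec _ _ r₂∸1≢0 ⟩
    ℕtoℚ (r₁ ∸ 1)      ≡⟨ r∸1≡tφ r₁ r₁≥1 ⟩
    t * x₁             ≡⟨ ℚP.*-comm t x₁ ⟩
    x₁ * t             ∎)
    where
    r₂∸1≢0 : ℕtoℚ (r₂ ∸ 1) ≢ 0ℚ
    r₂∸1≢0 e = *-nonzero t x₂ t≢0 x₂≢0 (trans (sym (r∸1≡tφ r₂ r₂≥1)) e)

  c₀x₂²ρ≡1 : c₀ * (x₂ * x₂) * ρ ≡ 1ℚ
  c₀x₂²ρ≡1 = begin
    c₀ * (x₂ * x₂) * ρ    ≡⟨ solve 3 (λ c b r → c :* (b :* b) :* r := c :* ((r :* b) :* b)) refl c₀ x₂ ρ ⟩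
    c₀ * ((ρ * x₂) * x₂)  ≡⟨ cong (λ w → c₀ * (w * x₂)) ρx₂≡x₁ ⟩
    c₀ * (x₁ * x₂)        ≡⟨ c₀x₁x₂≡1 ⟩
    1ℚ                    ∎

  ρ≡c₀x₁² : ρ ≡ c₀ * (x₁ * x₁)
  ρ≡c₀x₁² = sym (begin
    c₀ * (x₁ * x₁)        ≡⟨ cong (λ w → c₀ * (x₁ * w)) (sym ρx₂≡x₁) ⟩
    c₀ * (x₁ * (ρ * x₂))  ≡⟨ solve 4 (λ c a r b → c :* (a :* (r :* b)) := r :* (c :* (a :* b))) refl c₀ x₁ ρ x₂ ⟩
    ρ * (c₀ * (x₁ * x₂))  ≡⟨ cong (ρ *_) c₀x₁x₂≡1 ⟩
    ρ * 1ℚ                ≡⟨ ℚP.*-identityʳ ρ ⟩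
    ρ                     ∎)

  ρ⁻¹≡c₀x₂² : divℚ 1ℚ ρ ≡ c₀ * (x₂ * x₂)
  ρ⁻¹≡c₀x₂² = divℚ-unique 1ℚ ρ _ ρ≢0 c₀x₂²ρ≡1
    where ρ≢0 = factor≢0 ρ (c₀ * (x₂ * x₂)) (trans (ℚP.*-comm ρ _) c₀x₂²ρ≡1)

  R : Mat (e₁ ℕ.+ e₂)
  R = Rmat e₁ e₂ ρ

  R-rank-one : ∀ i j → R i j ≡ c₀ * (x i * x j)
  R-rank-one i j = trans (Rmat-rank-one e₁ e₂ ρ c₀ x₁ x₂ ρ≡c₀x₁² (sym c₀x₁x₂≡1) ρ⁻¹≡c₀x₂² i j)
    (sym (cong₂ (λ a b → c₀ * (a * b)) (x-classes i) (x-classes j)))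

  R-sym : Symmetric R
  R-sym i j = trans (R-rank-one i j)
    (trans (cong (c₀ *_) (ℚP.*-comm (x i) (x j))) (sym (R-rank-one j i)))

  I+R≈AΔ⁻¹Aᵀ : idMat ⊕ R ≈M A ⊗ (Δ⁻¹ ⊗ transpose A)
  I+R≈AΔ⁻¹Aᵀ i j = trans (cong (idMat i j +_) (R-rank-one i j)) (sym (AΔ⁻¹Aᵀ i j))

  -- Step 4.  The coefficient c = ρ/(λ(ρ+1)²) satisfies cλ = c₀ and cs = 1.
  c : ℚ
  c = divℚ ρ (λq * ((ρ + 1ℚ) * (ρ + 1ℚ)))

  λ≢0 : λq ≢ 0ℚ
  λ≢0 λ≡0 = factor≢0 c₀ (x₁ * x₂) c₀x₁x₂≡1
    (*-zero-cancelˡ s c₀ s≢0 (trans (ℚP.*-comm s c₀) (trans c₀s≡λ λ≡0)))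

  [ρ+1]x₂≡x₁+x₂ : (ρ + 1ℚ) * x₂ ≡ x₁ + x₂
  [ρ+1]x₂≡x₁+x₂ = trans (solve 2 (λ r b → (r :+ con 1ℚ) :* b := r :* b :+ b) refl ρ x₂)
                        (cong (_+ x₂) ρx₂≡x₁)

  ρ+1≢0 : ρ + 1ℚ ≢ 0ℚ
  ρ+1≢0 = factor≢0 (ρ + 1ℚ) (c₀ * x₂) (begin
    (ρ + 1ℚ) * (c₀ * x₂)  ≡⟨ solve 3 (λ a c b → a :* (c :* b) := c :* (a :* b)) refl (ρ + 1ℚ) c₀ x₂ ⟩
    c₀ * ((ρ + 1ℚ) * x₂)  ≡⟨ cong (c₀ *_) [ρ+1]x₂≡x₁+x₂ ⟩
    c₀ * (x₁ + x₂)        ≡⟨ c₀[x₁+x₂]≡1 ⟩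
    1ℚ                    ∎)

  -- ρ = c₀(ρ + 1)², because both sides multiplied by c₀x₂² equal 1.
  ρ≡c₀[ρ+1]² : ρ ≡ c₀ * ((ρ + 1ℚ) * (ρ + 1ℚ))
  ρ≡c₀[ρ+1]² = *-cancelʳ _ _ (c₀ * (x₂ * x₂)) c₀x₂²≢0 (trans (trans (ℚP.*-comm ρ _) c₀x₂²ρ≡1) (sym (begin
    c₀ * ((ρ + 1ℚ) * (ρ + 1ℚ)) * (c₀ * (x₂ * x₂))
      ≡⟨ solve 3 (λ c r b → c :* ((r :+ con 1ℚ) :* (r :+ con 1ℚ)) :* (c :* (b :* b))
                         := (c :* ((r :+ con 1ℚ) :* b)) :* (c :* ((r :+ con 1ℚ) :* b))) refl c₀ ρ x₂ ⟩
    (c₀ * ((ρ + 1ℚ) * x₂)) * (c₀ * ((ρ + 1ℚ) * x₂))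
      ≡⟨ cong (λ w → (c₀ * w) * (c₀ * w)) [ρ+1]x₂≡x₁+x₂ ⟩
    (c₀ * (x₁ + x₂)) * (c₀ * (x₁ + x₂))
      ≡⟨ cong (λ w → w * w) c₀[x₁+x₂]≡1 ⟩
    1ℚ ∎)))
    where c₀x₂²≢0 = factor≢0 _ ρ c₀x₂²ρ≡1

  cλ≡c₀ : c * λq ≡ c₀
  cλ≡c₀ = *-cancelʳ _ _ [ρ+1]² [ρ+1]²≢0 (begin
    c * λq * [ρ+1]²      ≡⟨ ℚP.*-assoc c λq [ρ+1]² ⟩
    c * (λq * [ρ+1]²)    ≡⟨ divℚ-spec ρ _ (*-nonzero λq [ρ+1]² λ≢0 [ρ+1]²≢0) ⟩
    ρ                    ≡⟨ ρ≡c₀[ρ+1]² ⟩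
    c₀ * [ρ+1]²          ∎)
    where
    [ρ+1]² = (ρ + 1ℚ) * (ρ + 1ℚ)
    [ρ+1]²≢0 = *-nonzero (ρ + 1ℚ) (ρ + 1ℚ) ρ+1≢0 ρ+1≢0

  cs≡1 : c * s ≡ 1ℚ
  cs≡1 = *-cancelʳ _ _ λq λ≢0 (begin
    c * s * λq   ≡⟨ solve 3 (λ a b e → a :* b :* e := a :* e :* b) refl c s λq ⟩
    c * λq * s   ≡⟨ cong (_* s) cλ≡c₀ ⟩
    c₀ * s       ≡⟨ c₀s≡λ ⟩
    λq           ≡⟨ sym (ℚP.*-identityˡ λq) ⟩
    1ℚ * λq      ∎)

  S : Mat (e₁ ℕ.+ e₂)
  S = idMat ⊖ (c · R)

  B : Mat (e₁ ℕ.+ e₂)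
  B = Δ⁻¹ ⊗ (transpose A ⊗ S)

  -- AᵀS = Aᵀ − c₀𝟏xᵀ, using R = c₀xxᵀ, Aᵀx = s𝟏 and cs = 1.
  AᵀS-entry : ∀ b j → (transpose A ⊗ S) b j ≡ A j b - c₀ * x j
  AᵀS-entry b j = begin
    sumℚ (e₁ ℕ.+ e₂) (λ l → A l b * (idMat l j - c * R l j))
      ≡⟨ sum-cong (e₁ ℕ.+ e₂) (λ l → trans (cong (λ w → A l b * (idMat l j - c * w)) (R-rank-one l j))
           (solve 6 (λ a e k c′ y z → a :* (e :- k :* (c′ :* (y :* z))) := a :* e :- (k :* c′ :* z) :* (a :* y))
                    refl (A l b) (idMat l j) c c₀ (x l) (x j))) ⟩
    sumℚ (e₁ ℕ.+ e₂) (λ l → A l b * idMat l j - (c * c₀ * x j) * (A l b * x l))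
      ≡⟨ trans (sum-- (e₁ ℕ.+ e₂) _ _) (cong₂ _-_ (sum-δʳ (e₁ ℕ.+ e₂) (λ l → A l b) j)
           (trans (sum-*ˡ (e₁ ℕ.+ e₂) (c * c₀ * x j) _) (cong (c * c₀ * x j *_) (Aᵀx b)))) ⟩
    A j b - c * c₀ * x j * s
      ≡⟨ cong (λ w → A j b - w) (solve 4 (λ k c′ y z → k :* c′ :* y :* z := (k :* z) :* (c′ :* y)) refl c c₀ (x j) s) ⟩
    A j b - (c * s) * (c₀ * x j)
      ≡⟨ cong (λ w → A j b - w * (c₀ * x j)) cs≡1 ⟩
    A j b - 1ℚ * (c₀ * x j)
      ≡⟨ cong (λ w → A j b - w) (ℚP.*-identityˡ (c₀ * x j)) ⟩
    A j b - c₀ * x j ∎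

  B≈G : B ≈M G
  B≈G b j = begin
    B b j                          ≡⟨ diag-⊗ d (transpose A ⊗ S) b j ⟩
    d b * (transpose A ⊗ S) b j    ≡⟨ cong (d b *_) (AᵀS-entry b j) ⟩
    d b * (A j b - c₀ * x j)
      ≡⟨ solve 4 (λ e a k y → e :* (a :- k :* y) := e :* a :- (k :* y) :* e) refl (d b) (A j b) c₀ (x j) ⟩
    d b * A j b - (c₀ * x j) * d b ≡⟨ sym (G-entry b j) ⟩
    G b j                          ∎

  A⊗B≈I : A ⊗ B ≈M idMat
  A⊗B≈I = ≈M-trans (⊗-congʳ A B≈G) G-right

  B⊗A≈I : B ⊗ A ≈M idMat
  B⊗A≈I = ≈M-trans (⊗-congˡ A B≈G) G-left

  -- (I + R)S = AΔ⁻¹AᵀS = AB = I.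
  I+R⊗S≈I : (idMat ⊕ R) ⊗ S ≈M idMat
  I+R⊗S≈I = ≈M-trans (⊗-congˡ S I+R≈AΔ⁻¹Aᵀ) (≈M-trans (⊗-assoc A (Δ⁻¹ ⊗ transpose A) S)
              (≈M-trans (⊗-congʳ A (⊗-assoc Δ⁻¹ (transpose A) S)) A⊗B≈I))

  -- I + R and S are symmetric, so S is also a left inverse of I + R.
  S⊗I+R≈I : S ⊗ (idMat ⊕ R) ≈M idMat
  S⊗I+R≈I = symmetric-inverse-comm (idMat ⊕ R) S
    (λ i j → cong₂ _+_ (idMat-sym i j) (R-sym i j))
    (λ i j → cong₂ (λ a b → a - c * b) (idMat-sym i j) (R-sym i j))
    I+R⊗S≈I

theorem1p10 : (e₁ e₂ : ℕ) (inc : Incidence (e₁ ℕ.+ e₂)) (λ' r₁ r₂ : ℕ) →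
  IsRyserDesign (e₁ ℕ.+ e₂) inc λ' →
  r₂ < r₁ → r₁ ℕ.+ r₂ ≡ suc (e₁ ℕ.+ e₂) → 0 < e₁ → 0 < e₂ →
  (∀ p → replication inc p ≡ (Data.Sum.[_,_] (λ _ → r₁) (λ _ → r₂) (splitAt e₁ p))) →
  let v  = e₁ ℕ.+ e₂
      ρ  = divℚ (ℕtoℚ (r₁ ∸ 1)) (ℕtoℚ (r₂ ∸ 1))
      A  = incMat inc
      R  = Rmat e₁ e₂ ρ
      Dinv = diag (λ b → divℚ 1ℚ (ℕtoℚ (blockSize inc b ∸ λ')))
      c  = divℚ ρ (ℕtoℚ λ' ℚ.* ((ρ ℚ.+ 1ℚ) ℚ.* (ρ ℚ.+ 1ℚ)))
      S  = idMat {v} ⊖ (c · R)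
      B  = Dinv ⊗ (transpose A ⊗ S)
  in ((idMat ⊕ R) ⊗ S ≈M idMat × S ⊗ (idMat ⊕ R) ≈M idMat)
     × (A ⊗ B ≈M idMat × B ⊗ A ≈M idMat)
theorem1p10 e₁ e₂ inc λ' r₁ r₂ D r₂<r₁ r₁+r₂≡v+1 0<e₁ 0<e₂ replication-classes =
  (I+R⊗S≈I , S⊗I+R≈I) , (A⊗B≈I , B⊗A≈I)
  where open RyserTwoClasses D r₂<r₁ r₁+r₂≡v+1 0<e₁ 0<e₂ replication-classes
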